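{- Let $p$ be a prime, $s\geq1$, $E_s=\{1\leq i\leq s+\lceil\frac{s}{p-1}-1\rceil:\ \gcd(i,p)=1\}$, and let $(c_i)_{i\geq 1}$ be the increasing enumeration of $F_s=\bigcup_{b\in E_s}\{p^jb:\ j\geq 0\}$. Let $n\geq 1$ and write $n=qs+r$ with integers $q\geq0$ and $1\leq r\leq s$. Then $c_n\geq p^qr$. -}

module Defs where

open import Data.Nat using (ℕ; zero; suc; _+_; _*_; _∸_; _^_; _≤_; _<_)
open import Data.Nat.DivMod using (_/_)
open import Data.Nat.Coprimality using (Coprime)
open import Data.Product using (_×_; ∃-syntax)
open import Relation.Binary.PropositionalEquality using (_≡_)

-- ceiling division ⌈ a / d ⌉ for d ≥ 1 (value 0 for d = 0, never used)
ceilDiv : ℕ → ℕ → ℕ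
ceilDiv a zero    = zero
ceilDiv a (suc d) = (a + d) / suc d

-- upper bound s + ⌈ s/(p-1) - 1 ⌉ = s + ⌈ s/(p-1) ⌉ - 1  (valid since s ≥ 1, p ≥ 2)
bound : ℕ → ℕ → ℕ
bound p s = s + ceilDiv s (p ∸ 1) ∸ 1

InE : ℕ → ℕ → ℕ → Set
InE p s i = (1 ≤ i) × (i ≤ bound p s) × Coprime i p

InF : ℕ → ℕ → ℕ → Set
InF p s m = ∃[ b ] ∃[ j ] (InE p s b × m ≡ p ^ j * b)

IsIncEnum : ℕ → ℕ → (ℕ → ℕ) → Set
IsIncEnum p s c =
  (∀ i j → 1 ≤ i → i < j → c i < c j) ×
  (∀ i → 1 ≤ i → InF p s (c i)) ×
  (∀ m → InF p s m → ∃[ i ] (1 ≤ i × c i ≡ m))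

{-# OPTIONS --safe #-}
-- For n ≥ 1 one has c (n + s) ≥ p · c n. Otherwise c 1, …, c (n + s) all lie below p · c n,
-- and each such element of F is either p · c k with k < n, or an element of E; but there
-- are at most n − 1 of the former, and at most s of the latter, because the map
-- b ↦ #{1 ≤ a < b : gcd (a , p) = 1} maps E injectively below s. Iterating q times
-- from c r ≥ r gives c (q s + r) ≥ p ^ q · r.
module Submission where

open import Defs
open import Data.Nat
  using (ℕ; zero; suc; _+_; _*_; _^_; _≤_; _<_; _∸_; z≤n; s≤s; s≤s⁻¹; NonZero; >-nonZero)
open import Data.Nat.Properties
open import Data.Nat.DivMod
  using ( _%_; _/_; m≡m%n+[m/n]*n; m%n<n; [m+kn]%n≡m%n; m<n⇒m%n≡m
        ; m<n⇒m/n≡0; m*n/n≡m; m/n*n≤m; +-distrib-/-∣ʳ)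
open import Data.Nat.Divisibility using (divides; ∣-refl; m%n≡0⇒n∣m)
open import Data.Nat.Coprimality using (Coprime)
open import Data.Nat.Primality using (Prime)
open import Data.Nat.Tactic.RingSolver using (solve-∀)
open import Data.Fin using (Fin; toℕ; fromℕ<)
open import Data.Fin.Properties using (toℕ<n; toℕ-fromℕ<; toℕ-injective; injective⇒≤)
open import Data.Product using (_×_; _,_; proj₁; proj₂; ∃-syntax)
open import Data.Sum using (inj₁; inj₂)
open import Relation.Nullary using (yes; no; contradiction)
open import Relation.Binary.Definitions using (tri<; tri≈; tri>)
open import Relation.Binary.PropositionalEquality

quotient-remainder-unique : ∀ {n u u′ q q′} → u < suc n → u′ < suc n →
                            u + q * suc n ≡ u′ + q′ * suc n → u ≡ u′ × q ≡ q′
quotient-remainder-unique {n} {u} {u′} {q} {q′} u<n u′<n eq =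
  (begin
    u                          ≡⟨ m<n⇒m%n≡m u<n ⟨
    u % suc n                  ≡⟨ [m+kn]%n≡m%n u q (suc n) ⟨
    (u + q * suc n) % suc n    ≡⟨ cong (_% suc n) eq ⟩
    (u′ + q′ * suc n) % suc n  ≡⟨ [m+kn]%n≡m%n u′ q′ (suc n) ⟩
    u′ % suc n                 ≡⟨ m<n⇒m%n≡m u′<n ⟩
    u′                         ∎)
  , (begin
    q                          ≡⟨ quotient u<n ⟨
    (u + q * suc n) / suc n    ≡⟨ cong (_/ suc n) eq ⟩
    (u′ + q′ * suc n) / suc n  ≡⟨ quotient u′<n ⟩
    q′                         ∎)
  where
  open ≡-Reasoning
  quotient : ∀ {u q} → u < suc n → (u + q * suc n) / suc n ≡ q
  quotient {u} {q} u<n = begin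
    (u + q * suc n) / suc n          ≡⟨ +-distrib-/-∣ʳ u (divides q refl) ⟩
    u / suc n + q * suc n / suc n    ≡⟨ cong₂ _+_ (m<n⇒m/n≡0 u<n) (m*n/n≡m q (suc n)) ⟩
    q                                ∎

<ceilDiv⇒*< : ∀ {k s} m → k < ceilDiv s (suc m) → k * suc m < s
<ceilDiv⇒*< {k} {s} m k<⌈s/1+m⌉ = +-cancelʳ-< m _ _ (begin-strict
  k * suc m + m            <⟨ +-monoʳ-< (k * suc m) (n<1+n m) ⟩
  k * suc m + suc m        ≡⟨ +-comm (k * suc m) (suc m) ⟩
  suc k * suc m            ≤⟨ *-monoˡ-≤ (suc m) k<⌈s/1+m⌉ ⟩
  (s + m) / suc m * suc m  ≤⟨ m/n*n≤m (s + m) (suc m) ⟩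
  s + m                    ∎)
  where open ≤-Reasoning

module CoprimeCounting (d : ℕ) where
  p : ℕ
  p = suc (suc d)

  -- For b coprime to p this is the number of positive integers below b coprime to p.
  coprimesBelow : ℕ → ℕ
  coprimesBelow b = b % p ∸ 1 + b / p * suc d

  coprime⇒%>0 : ∀ {b} → Coprime b p → 0 < b % p
  coprime⇒%>0 {b} b⊥p with b % p in b%p≡
  ... | suc _ = s≤s z≤n
  ... | zero  = contradiction (b⊥p (m%n≡0⇒n∣m b p b%p≡ , ∣-refl)) λ ()

  %∸1<p∸1 : ∀ b → b % p ∸ 1 < suc d
  %∸1<p∸1 b = s≤s (∸-monoˡ-≤ 1 (s≤s⁻¹ (m%n<n b p)))

  coprime-divMod : ∀ {b} → Coprime b p → b ≡ suc (b % p ∸ 1) + b / p * p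
  coprime-divMod {b} b⊥p = begin
    b                            ≡⟨ m≡m%n+[m/n]*n b p ⟩
    b % p + b / p * p            ≡⟨ cong (_+ b / p * p) (suc-pred (b % p) {{>-nonZero b%p>0}}) ⟨
    suc (b % p ∸ 1) + b / p * p  ∎
    where
    open ≡-Reasoning
    b%p>0 : 0 < b % p
    b%p>0 = coprime⇒%>0 b⊥p

  coprimesBelow-injective : ∀ {b b′} → Coprime b p → Coprime b′ p →
                            coprimesBelow b ≡ coprimesBelow b′ → b ≡ b′
  coprimesBelow-injective {b} {b′} b⊥p b′⊥p eq
    with quotient-remainder-unique {q = b / p} {q′ = b′ / p} (%∸1<p∸1 b) (%∸1<p∸1 b′) eq
  ... | u≡u′ , q≡q′ = begin
    b                                ≡⟨ coprime-divMod b⊥p ⟩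
    suc (b % p ∸ 1) + b / p * p      ≡⟨ cong₂ (λ u q → suc u + q * p) u≡u′ q≡q′ ⟩
    suc (b′ % p ∸ 1) + b′ / p * p    ≡⟨ coprime-divMod b′⊥p ⟨
    b′                               ∎
    where open ≡-Reasoning

  coprimesBelow<s : ∀ {s b} → Coprime b p → b ≤ bound p s → coprimesBelow b < s
  coprimesBelow<s {s} {b} b⊥p b≤bound with suc (b / p) <? ceilDiv s (suc d)
  ... | yes q+1<⌈s/p-1⌉ = begin-strict
    coprimesBelow b        <⟨ +-monoˡ-< (b / p * suc d) (%∸1<p∸1 b) ⟩
    suc (b / p) * suc d    <⟨ <ceilDiv⇒*< d q+1<⌈s/p-1⌉ ⟩
    s                      ∎
    where open ≤-Reasoning
  ... | no q+1≮⌈s/p-1⌉ = +-cancelʳ-≤ (b / p) _ _ (begin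
    suc (coprimesBelow b) + b / p  ≡⟨ regroup (b % p ∸ 1) (b / p) ⟩
    suc (b % p ∸ 1) + b / p * p    ≡⟨ coprime-divMod b⊥p ⟨
    b                              ≤⟨ b≤bound ⟩
    s + ceilDiv s (suc d) ∸ 1      ≤⟨ ∸-monoˡ-≤ 1 (+-monoʳ-≤ s (≮⇒≥ q+1≮⌈s/p-1⌉)) ⟩
    s + suc (b / p) ∸ 1            ≡⟨ cong (_∸ 1) (+-suc s (b / p)) ⟩
    s + b / p                      ∎)
    where
    open ≤-Reasoning
    regroup : ∀ u q → suc (u + q * suc d) + q ≡ suc u + q * suc (suc d)
    regroup = solve-∀

injectiveRelation⇒≤ : ∀ {n m} (R : ℕ → ℕ → Set) →
                      (∀ i → i < n → ∃[ k ] (k < m × R i k)) →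
                      (∀ {i j k} → R i k → R j k → i ≡ j) → n ≤ m
injectiveRelation⇒≤ {n} {m} R total injective = injective⇒≤ f-injective
  where
  f : Fin n → Fin m
  f i = fromℕ< (proj₁ (proj₂ (total (toℕ i) (toℕ<n i))))

  toℕ-f : ∀ i → R (toℕ i) (toℕ (f i))
  toℕ-f i with total (toℕ i) (toℕ<n i)
  ... | k , k<m , Rik = subst (R (toℕ i)) (sym (toℕ-fromℕ< k<m)) Rik

  f-injective : ∀ {i j} → f i ≡ f j → i ≡ j
  f-injective {i} {j} fi≡fj =
    toℕ-injective (injective (toℕ-f i) (subst (R (toℕ j)) (cong toℕ (sym fi≡fj)) (toℕ-f j)))

module StrictlyIncreasing {c : ℕ → ℕ} (c-incr : ∀ i j → 1 ≤ i → i < j → c i < c j) where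
  c-mono : ∀ {i j} → 1 ≤ i → i ≤ j → c i ≤ c j
  c-mono {i} {j} 1≤i i≤j with m≤n⇒m<n∨m≡n i≤j
  ... | inj₁ i<j  = <⇒≤ (c-incr i j 1≤i i<j)
  ... | inj₂ refl = ≤-refl

  c-injective : ∀ {i j} → 1 ≤ i → 1 ≤ j → c i ≡ c j → i ≡ j
  c-injective {i} {j} 1≤i 1≤j ci≡cj with <-cmp i j
  ... | tri< i<j _ _ = contradiction ci≡cj (<⇒≢ (c-incr i j 1≤i i<j))
  ... | tri≈ _ i≡j _ = i≡j
  ... | tri> _ _ j<i = contradiction ci≡cj (>⇒≢ (c-incr j i 1≤j j<i))

  c-cancel-< : ∀ {i j} → 1 ≤ j → c i < c j → i < j
  c-cancel-< 1≤j ci<cj = ≰⇒> λ j≤i → <⇒≱ ci<cj (c-mono 1≤j j≤i)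

  c-≥-id : 1 ≤ c 1 → ∀ i → 1 ≤ i → i ≤ c i
  c-≥-id 1≤c₁ (suc zero)    _ = 1≤c₁
  c-≥-id 1≤c₁ (suc (suc i)) _ =
    <-≤-trans (s≤s (c-≥-id 1≤c₁ (suc i) (s≤s z≤n)))
              (c-incr (suc i) (suc (suc i)) (s≤s z≤n) ≤-refl)

InF-positive : ∀ {p s x} .{{_ : NonZero p}} → InF p s x → 0 < x
InF-positive {p} (b , j , (1≤b , _) , x≡pʲb) =
  subst (0 <_) (sym x≡pʲb) (*-mono-≤ (m^n>0 p j) 1≤b)

module Enumeration (d s : ℕ) (c : ℕ → ℕ) (enum : IsIncEnum (suc (suc d)) s c) where
  open CoprimeCounting d
  open StrictlyIncreasing (proj₁ enum)

  c-in-F : ∀ i → 1 ≤ i → InF p s (c i)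
  c-in-F = proj₁ (proj₂ enum)

  c-onto : ∀ x → InF p s x → ∃[ i ] (1 ≤ i × c i ≡ x)
  c-onto = proj₂ (proj₂ enum)

  -- An element of F below p · c (1 + m) has a label below m + s, and the label determines it.
  data Label (m x k : ℕ) : Set where
    scaled : k < m → p * c (suc k) ≡ x → Label m x k
    base   : ∀ {b} → Coprime b p → b ≡ x → k ≡ m + coprimesBelow b → Label m x k

  Label-functional : ∀ {m x y k} → Label m x k → Label m y k → x ≡ y
  Label-functional (scaled _ pc≡x) (scaled _ pc≡y) = trans (sym pc≡x) pc≡y
  Label-functional (scaled k<m _) (base _ _ refl) = contradiction k<m (m+n≮m _ _)
  Label-functional (base _ _ refl) (scaled k<m _) = contradiction k<m (m+n≮m _ _)
  Label-functional {m} (base b⊥p b≡x refl) (base b′⊥p b′≡y m+r≡m+r′) =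
    trans (sym b≡x) (trans (coprimesBelow-injective b⊥p b′⊥p (+-cancelˡ-≡ m _ _ m+r≡m+r′)) b′≡y)

  label : ∀ {m x} → InF p s x → x < p * c (suc m) → ∃[ k ] (k < m + s × Label m x k)
  label {m} (b , zero , (_ , b≤bound , b⊥p) , x≡1*b) _ =
    m + coprimesBelow b , +-monoʳ-< m (coprimesBelow<s {s} b⊥p b≤bound) ,
    base b⊥p (sym (trans x≡1*b (*-identityˡ b))) refl
  label {m} {x} (b , suc j , b∈E , x≡p¹⁺ʲb) x<pc with c-onto (p ^ j * b) (b , j , b∈E , refl)
  ... | suc k , _ , c[1+k]≡pʲb = k , <-≤-trans k<m (m≤m+n m s) , scaled k<m pc≡x
    where
    pc≡x : p * c (suc k) ≡ x
    pc≡x = trans (cong (p *_) c[1+k]≡pʲb) (trans (sym (*-assoc p (p ^ j) b)) (sym x≡p¹⁺ʲb))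
    k<m : k < m
    k<m = s≤s⁻¹ (c-cancel-< (s≤s z≤n) (*-cancelˡ-< p _ _ pc[1+k]<pc[1+m]))
      where
      pc[1+k]<pc[1+m] : p * c (suc k) < p * c (suc m)
      pc[1+k]<pc[1+m] = subst (_< p * c (suc m)) (sym pc≡x) x<pc

  p*c[n]≤c[n+s] : ∀ n → 1 ≤ n → p * c n ≤ c (n + s)
  p*c[n]≤c[n+s] (suc m) _ = ≮⇒≥ λ c[n+s]<pcₙ →
    1+n≰n (injectiveRelation⇒≤ (λ i → Label m (c (suc i))) (labelled c[n+s]<pcₙ) Label-injective)
    where
    labelled : c (suc m + s) < p * c (suc m) →
               ∀ i → i < suc m + s → ∃[ k ] (k < m + s × Label m (c (suc i)) k)
    labelled c[n+s]<pcₙ i i<n+s =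
      label (c-in-F (suc i) (s≤s z≤n)) (≤-<-trans (c-mono (s≤s z≤n) i<n+s) c[n+s]<pcₙ)
    Label-injective : ∀ {i j k} → Label m (c (suc i)) k → Label m (c (suc j)) k → i ≡ j
    Label-injective ℓᵢ ℓⱼ =
      suc-injective (c-injective (s≤s z≤n) (s≤s z≤n) (Label-functional ℓᵢ ℓⱼ))

  p^q*r≤c[qs+r] : ∀ q r → 1 ≤ r → p ^ q * r ≤ c (q * s + r)
  p^q*r≤c[qs+r] zero    r 1≤r =
    ≤-trans (≤-reflexive (*-identityˡ r)) (c-≥-id 1≤c₁ r 1≤r)
    where
    1≤c₁ : 1 ≤ c 1
    1≤c₁ = InF-positive {s = s} (c-in-F 1 (s≤s z≤n))
  p^q*r≤c[qs+r] (suc q) r 1≤r = begin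
    p ^ suc q * r      ≡⟨ *-assoc p (p ^ q) r ⟩
    p * (p ^ q * r)    ≤⟨ *-monoʳ-≤ p (p^q*r≤c[qs+r] q r 1≤r) ⟩
    p * c (q * s + r)  ≤⟨ p*c[n]≤c[n+s] (q * s + r) (≤-trans 1≤r (m≤n+m r (q * s))) ⟩
    c (q * s + r + s)  ≡⟨ cong c (trans (+-comm (q * s + r) s) (sym (+-assoc s (q * s) r))) ⟩
    c (suc q * s + r)  ∎
    where open ≤-Reasoning

lemma1p8 : (p s : ℕ) → Prime p → 1 ≤ s → (c : ℕ → ℕ) → IsIncEnum p s c →
           (n q r : ℕ) → 1 ≤ n → n ≡ q * s + r → 1 ≤ r → r ≤ s →
           p ^ q * r ≤ c n
lemma1p8 zero          _ () _ _ _ _ _ _ _ _ _ _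
lemma1p8 (suc zero)    _ () _ _ _ _ _ _ _ _ _ _
lemma1p8 (suc (suc d)) s _ _ c enum _ q r _ refl 1≤r _ =
  Enumeration.p^q*r≤c[qs+r] d s c enum q r 1≤r
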